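{- Let $G$ be a $3$-connected graph and let $H$ be a $3$-connected subgraph of $G$. Suppose $v$ is an $H$-private vertex and $\{A,B\}$ is a $3$-separation of $G$ with $v\in V(A)\cap V(B)$. Then $\{(A\cap H)-v,\,(B\cap H)-v\}$ is a $2$-separation of $H-v$.
   Context: All graphs are finite and simple. A vertex $v$ of $G$ is $H$-private if $N[v]\subseteq V(H)$, where $N[v]$ is $v$ together with its neighbors in $G$. For a nonnegative integer $k$, a $k$-separation of a graph $G$ is a pair $\{G_1,G_2\}$ of edge-disjoint subgraphs with $G_1\cup G_2=G$, $|V(G_1)\cap V(G_2)|=k$ and $\min\{|V(G_1)|,|V(G_2)|\}\ge k+1$ (isolated vertices allowed). A graph is $3$-connected if it has more than $3$ vertices and no vertex cut of size less than $3$. $A\cap H$ is the subgraph with vertex set $V(A)\cap V(H)$ and edge set $E(A)\cap E(H)$. -}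

module Defs where

open import Data.Nat using (ℕ; suc; _<_; _≤_)
open import Data.Bool using (Bool; true; false; _∧_; _∨_; not)
open import Data.Fin using (Fin)
open import Data.Fin.Subset using (Subset; _∈_; _⊆_; _∩_; _∪_; _─_; ⁅_⁆; ∣_∣)
open import Data.Fin.Subset.Properties using (_∈?_)
open import Data.Product using (_×_)
open import Relation.Nullary using (¬_)
open import Relation.Nullary.Decidable using (⌊_⌋)
open import Relation.Binary.PropositionalEquality using (_≡_)

record RawGraph (n : ℕ) : Set where
  constructor mkGraph
  field
    V : Subset n
    E : Fin n → Fin n → Bool

open RawGraph public

Edge : ∀ {n} → RawGraph n → Fin n → Fin n → Set
Edge G u w = E G u w ≡ true

IsGraph : ∀ {n} → RawGraph n → Set
IsGraph G =
  (∀ u w → Edge G u w → Edge G w u) ×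
  (∀ u → ¬ Edge G u u) ×
  (∀ u w → Edge G u w → u ∈ V G)

Subgraph : ∀ {n} → RawGraph n → RawGraph n → Set
Subgraph H G = (V H ⊆ V G) × (∀ u w → Edge H u w → Edge G u w)

_⊓_ : ∀ {n} → RawGraph n → RawGraph n → RawGraph n
A ⊓ H = mkGraph (V A ∩ V H) (λ u w → E A u w ∧ E H u w)

deleteSet : ∀ {n} → RawGraph n → Subset n → RawGraph n
deleteSet G S = mkGraph (V G ─ S)
  (λ u w → E G u w ∧ not ⌊ u ∈? S ⌋ ∧ not ⌊ w ∈? S ⌋)

_-v_ : ∀ {n} → RawGraph n → Fin n → RawGraph n
G -v v = deleteSet G ⁅ v ⁆

data Path {n} (G : RawGraph n) : Fin n → Fin n → Set where
  here : ∀ {u} → u ∈ V G → Path G u u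
  step : ∀ {u x w} → Edge G u x → Path G x w → Path G u w

Connected : ∀ {n} → RawGraph n → Set
Connected G = ∀ u w → u ∈ V G → w ∈ V G → Path G u w

ThreeConnected : ∀ {n} → RawGraph n → Set
ThreeConnected {n} G =
  (3 < ∣ V G ∣) ×
  (∀ (S : Subset n) → S ⊆ V G → ∣ S ∣ < 3 → Connected (deleteSet G S))

Private : ∀ {n} → RawGraph n → RawGraph n → Fin n → Set
Private G H v = (v ∈ V H) × (∀ u → Edge G v u → u ∈ V H)

IsSeparation : ∀ {n} → ℕ → RawGraph n → RawGraph n → RawGraph n → Set
IsSeparation k K G₁ G₂ =
  IsGraph G₁ × IsGraph G₂ ×
  (∀ u w → ¬ (Edge G₁ u w × Edge G₂ u w)) ×
  (V G₁ ∪ V G₂ ≡ V K) ×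
  (∀ u w → E K u w ≡ (E G₁ u w ∨ E G₂ u w)) ×
  (∣ V G₁ ∩ V G₂ ∣ ≡ k) ×
  (suc k ≤ ∣ V G₁ ∣) × (suc k ≤ ∣ V G₂ ∣)

{-# OPTIONS --safe #-}
module Submission where

-- Since G is 3-connected, the two separator vertices other than v do not separate G, so a walk
-- in G from A ∖ B to v enters V(A) ∩ V(B) at v: v has a neighbour in A ∖ B and, symmetrically,
-- one in B ∖ A, and both lie in H because v is H-private. A walk in H between these neighbours
-- must meet V(A) ∩ V(B), so 3-connectivity of H forces the whole separator into H. Hence the
-- restricted pieces of H - v meet exactly in the two remaining separator vertices, and the two
-- neighbours keep each piece larger than that.

open import Defs
open import Data.Nat using (ℕ; suc; _≤_; _<_)
open import Data.Nat.Properties using (≤-antisym; ≮⇒≥; <⇒≱; suc-injective)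
open import Data.Bool using (true; false; _∧_; _∨_; not)
open import Data.Bool.Properties
  using (∧-conicalˡ; ∧-conicalʳ; ∧-zeroʳ; ∧-identityʳ; ∧-distribʳ-∨; ∨-comm)
open import Data.Fin using (Fin; zero)
open import Data.Fin.Properties using (any?) renaming (_≟_ to _≟ᶠ_)
open import Data.Fin.Subset using (Subset; _∈_; _∉_; _⊆_; _∩_; _∪_; _─_; _-_; ⁅_⁆; ∣_∣)
open import Data.Fin.Subset.Properties
open import Data.Vec.Base using (_∷_; here; there)
open import Data.Product using (_×_; _,_; proj₁; proj₂; ∃; ∃₂; swap)
open import Data.Sum using (_⊎_; inj₁; inj₂)
open import Function using (_∘_)
open import Relation.Nullary using (¬_; yes; no; contradiction)
open import Relation.Nullary.Decidable using (⌊_⌋; _×-dec_; ¬?)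
open import Relation.Binary.PropositionalEquality
  using (_≡_; refl; sym; trans; cong; cong₂; subst; module ≡-Reasoning)

private variable
  n k : ℕ
  G H K A B : RawGraph n
  u w v x : Fin n
  p q : Subset n

∧-true⁻ : ∀ {a b} → a ∧ b ≡ true → a ≡ true × b ≡ true
∧-true⁻ {a} {b} a∧b = ∧-conicalˡ a b a∧b , ∧-conicalʳ a b a∧b

∨-true⁻ : ∀ {a b} → a ∨ b ≡ true → a ≡ true ⊎ b ≡ true
∨-true⁻ {true}  _ = inj₁ refl
∨-true⁻ {false} b = inj₂ b

∧-∨-restrict : ∀ a b h c → (h ≡ true → a ∨ b ≡ true) →
               h ∧ c ≡ ((a ∧ h) ∧ c) ∨ ((b ∧ h) ∧ c)
∧-∨-restrict a b h c h⇒a∨b = begin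
  h ∧ c                          ≡⟨ cong (_∧ c) (absorb h h⇒a∨b) ⟨
  ((a ∨ b) ∧ h) ∧ c              ≡⟨ cong (_∧ c) (∧-distribʳ-∨ h a b) ⟩
  ((a ∧ h) ∨ (b ∧ h)) ∧ c        ≡⟨ ∧-distribʳ-∨ c (a ∧ h) (b ∧ h) ⟩
  ((a ∧ h) ∧ c) ∨ ((b ∧ h) ∧ c)  ∎
  where
  open ≡-Reasoning
  absorb : ∀ h → (h ≡ true → a ∨ b ≡ true) → (a ∨ b) ∧ h ≡ h
  absorb false _     = ∧-zeroʳ (a ∨ b)
  absorb true  a∨b≡t = trans (∧-identityʳ (a ∨ b)) (a∨b≡t refl)

not-∈?⁺ : {S : Subset n} → u ∉ S → not ⌊ u ∈? S ⌋ ≡ true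
not-∈?⁺ {u = u} {S} u∉S with u ∈? S
... | yes u∈S = contradiction u∈S u∉S
... | no  _   = refl

not-∈?⁻ : {S : Subset n} → not ⌊ u ∈? S ⌋ ≡ true → u ∉ S
not-∈?⁻ {u = u} {S} ¬u∈S with u ∈? S
not-∈?⁻ () | yes _
... | no u∉S = u∉S

x∈p─q⇒x∉q : ∀ (p q : Subset n) → x ∈ p ─ q → x ∉ q
x∈p─q⇒x∉q {x = zero} (_ ∷ p) (true  ∷ q) ()
x∈p─q⇒x∉q {x = zero} (_ ∷ p) (false ∷ q) here ()
x∈p─q⇒x∉q (_ ∷ p) (_ ∷ q) (there x∈p─q) (there x∈q) = x∈p─q⇒x∉q p q x∈p─q x∈q

x∈p─q⁻ : ∀ (p q : Subset n) → x ∈ p ─ q → x ∈ p × x ∉ q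
x∈p─q⁻ p q x∈p─q = p─q⊆p p q x∈p─q , x∈p─q⇒x∉q p q x∈p─q

x∈p⇒∣p∣≡suc∣p-x∣ : x ∈ p → ∣ p ∣ ≡ suc ∣ p - x ∣
x∈p⇒∣p∣≡suc∣p-x∣ {p = _ ∷ p}     here        = cong (suc ∘ ∣_∣) (sym (p─⊥≡p p))
x∈p⇒∣p∣≡suc∣p-x∣ {p = true  ∷ _} (there x∈p) = cong suc (x∈p⇒∣p∣≡suc∣p-x∣ x∈p)
x∈p⇒∣p∣≡suc∣p-x∣ {p = false ∷ _} (there x∈p) = x∈p⇒∣p∣≡suc∣p-x∣ x∈p

x∈p∧x∉p-y⇒x≡y : ∀ {y} → x ∈ p → x ∉ p - y → x ≡ y
x∈p∧x∉p-y⇒x≡y {x = x} {y = y} x∈p x∉p-y with x ≟ᶠ y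
... | yes x≡y = x≡y
... | no  x≢y = contradiction (x∈p∧x≢y⇒x∈p-y x∈p x≢y) x∉p-y

x∈p∧x∉q⇒∣p∩q∣<∣p∣ : x ∈ p → x ∉ q → ∣ p ∩ q ∣ < ∣ p ∣
x∈p∧x∉q⇒∣p∩q∣<∣p∣ {p = p} {q = q} x∈p x∉q =
  p⊂q⇒∣p∣<∣q∣ (p∩q⊆p p q , _ , x∈p , x∉q ∘ proj₂ ∘ x∈p∩q⁻ p q)

∣p∩q∣<∣p∣⇒x∈p∧x∉q : ∣ p ∩ q ∣ < ∣ p ∣ → ∃ λ x → x ∈ p × x ∉ q
∣p∩q∣<∣p∣⇒x∈p∧x∉q {p = p} {q = q} ∣p∩q∣<∣p∣ with any? (λ x → x ∈? p ×-dec ¬? (x ∈? q))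
... | yes x∈p─q = x∈p─q
... | no  ∄x∈p─q = contradiction (p⊆q⇒∣p∣≤∣q∣ p⊆p∩q) (<⇒≱ ∣p∩q∣<∣p∣)
  where
  p⊆p∩q : p ⊆ p ∩ q
  p⊆p∩q {x} x∈p with x ∈? q
  ... | yes x∈q = x∈p∩q⁺ (x∈p , x∈q)
  ... | no  x∉q = contradiction (x , x∈p , x∉q) ∄x∈p─q

∪-restrict : ∀ (p q r s : Subset n) → r ⊆ p ∪ q → (p ∩ r ─ s) ∪ (q ∩ r ─ s) ≡ r ─ s
∪-restrict p q r s r⊆p∪q = ⊆-antisym ⊆r─s r─s⊆
  where
  ⊆r─s : (p ∩ r ─ s) ∪ (q ∩ r ─ s) ⊆ r ─ s
  ⊆r─s x∈ with x∈p∪q⁻ _ _ x∈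
  ... | inj₁ x∈p∩r─s = let x∈p∩r , x∉s = x∈p─q⁻ _ s x∈p∩r─s in
                       x∈p∧x∉q⇒x∈p─q (proj₂ (x∈p∩q⁻ p r x∈p∩r)) x∉s
  ... | inj₂ x∈q∩r─s = let x∈q∩r , x∉s = x∈p─q⁻ _ s x∈q∩r─s in
                       x∈p∧x∉q⇒x∈p─q (proj₂ (x∈p∩q⁻ q r x∈q∩r)) x∉s
  r─s⊆ : r ─ s ⊆ (p ∩ r ─ s) ∪ (q ∩ r ─ s)
  r─s⊆ x∈r─s with x∈r , x∉s ← x∈p─q⁻ r s x∈r─s | x∈p∪q⁻ p q (r⊆p∪q x∈r)
  ... | inj₁ x∈p = x∈p∪q⁺ (inj₁ (x∈p∧x∉q⇒x∈p─q (x∈p∩q⁺ (x∈p , x∈r)) x∉s))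
  ... | inj₂ x∈q = x∈p∪q⁺ (inj₂ (x∈p∧x∉q⇒x∈p─q (x∈p∩q⁺ (x∈q , x∈r)) x∉s))

∩-restrict : ∀ (p q r s : Subset n) → (p ∩ r ─ s) ∩ (q ∩ r ─ s) ≡ (p ∩ q) ∩ r ─ s
∩-restrict p q r s = ⊆-antisym ⊆pqr─s pqr─s⊆
  where
  ⊆pqr─s : (p ∩ r ─ s) ∩ (q ∩ r ─ s) ⊆ (p ∩ q) ∩ r ─ s
  ⊆pqr─s x∈ =
    let x∈p∩r─s , x∈q∩r─s = x∈p∩q⁻ _ _ x∈
        x∈p∩r , x∉s = x∈p─q⁻ _ s x∈p∩r─s
        x∈p , x∈r = x∈p∩q⁻ p r x∈p∩r
        x∈q = proj₁ (x∈p∩q⁻ q r (p─q⊆p _ s x∈q∩r─s))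
    in x∈p∧x∉q⇒x∈p─q (x∈p∩q⁺ (x∈p∩q⁺ (x∈p , x∈q) , x∈r)) x∉s
  pqr─s⊆ : (p ∩ q) ∩ r ─ s ⊆ (p ∩ r ─ s) ∩ (q ∩ r ─ s)
  pqr─s⊆ x∈ =
    let x∈pq∩r , x∉s = x∈p─q⁻ _ s x∈
        x∈p∩q , x∈r = x∈p∩q⁻ _ r x∈pq∩r
        x∈p , x∈q = x∈p∩q⁻ p q x∈p∩q
    in x∈p∩q⁺ ( x∈p∧x∉q⇒x∈p─q (x∈p∩q⁺ (x∈p , x∈r)) x∉s
              , x∈p∧x∉q⇒x∈p─q (x∈p∩q⁺ (x∈q , x∈r)) x∉s)

Edge⇒source∈V : IsGraph K → Edge K u w → u ∈ V K
Edge⇒source∈V (_ , _ , E⊆V) = E⊆V _ _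

Edge⇒target∈V : IsGraph K → Edge K u w → w ∈ V K
Edge⇒target∈V (E-sym , _ , E⊆V) = E⊆V _ _ ∘ E-sym _ _

deleteSet-edge⁻ : ∀ K S → Edge (deleteSet K S) u w → Edge K u w × u ∉ S × w ∉ S
deleteSet-edge⁻ K S e =
  let e , u∉S∧w∉S = ∧-true⁻ e
      u∉S , w∉S = ∧-true⁻ u∉S∧w∉S
  in e , not-∈?⁻ u∉S , not-∈?⁻ w∉S

deleteSet-edge⁺ : ∀ K S → Edge K u w → u ∉ S → w ∉ S → Edge (deleteSet K S) u w
deleteSet-edge⁺ K S e u∉S w∉S = cong₂ _∧_ e (cong₂ _∧_ (not-∈?⁺ u∉S) (not-∈?⁺ w∉S))

⊓-edge⁻ : ∀ A H → Edge (A ⊓ H) u w → Edge A u w × Edge H u w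
⊓-edge⁻ A H = ∧-true⁻

⊓-edge⁺ : ∀ A H → Edge A u w → Edge H u w → Edge (A ⊓ H) u w
⊓-edge⁺ A H = cong₂ _∧_

deleteSet-isGraph : ∀ (K : RawGraph n) S → IsGraph K → IsGraph (deleteSet K S)
deleteSet-isGraph K S (E-sym , E-irrefl , E⊆V) =
  (λ u w e → let e , u∉S , w∉S = deleteSet-edge⁻ K S e in deleteSet-edge⁺ K S (E-sym u w e) w∉S u∉S) ,
  (λ u e → E-irrefl u (proj₁ (deleteSet-edge⁻ K S e))) ,
  (λ u w e → let e , u∉S , _ = deleteSet-edge⁻ K S e in x∈p∧x∉q⇒x∈p─q (E⊆V u w e) u∉S)

⊓-isGraph : ∀ (A H : RawGraph n) → IsGraph A → IsGraph H → IsGraph (A ⊓ H)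
⊓-isGraph A H (A-sym , A-irrefl , A⊆V) (H-sym , _ , H⊆V) =
  (λ u w e → let eA , eH = ⊓-edge⁻ A H e in ⊓-edge⁺ A H (A-sym u w eA) (H-sym u w eH)) ,
  (λ u e → A-irrefl u (proj₁ (⊓-edge⁻ A H e))) ,
  (λ u w e → let eA , eH = ⊓-edge⁻ A H e in x∈p∩q⁺ (A⊆V u w eA , H⊆V u w eH))

IsSeparation-sym : IsSeparation k K A B → IsSeparation k K B A
IsSeparation-sym {A = A} {B = B} (gA , gB , disjoint , V≡ , E≡ , ∣A∩B∣≡k , ∣A∣>k , ∣B∣>k) =
  gB , gA , (λ u w → disjoint u w ∘ swap) ,
  trans (∪-comm (V B) (V A)) V≡ ,
  (λ u w → trans (E≡ u w) (∨-comm (E A u w) (E B u w))) ,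
  trans (cong ∣_∣ (∩-comm (V B) (V A))) ∣A∩B∣≡k , ∣B∣>k , ∣A∣>k

separation-V⊆ : IsSeparation k G A B → V A ⊆ V G
separation-V⊆ (_ , _ , _ , V≡ , _) x∈A = subst (_ ∈_) V≡ (x∈p∪q⁺ (inj₁ x∈A))

separation-edge : IsSeparation k G A B → Edge G u w → Edge A u w ⊎ Edge B u w
separation-edge {u = u} {w = w} (_ , _ , _ , _ , E≡ , _) e = ∨-true⁻ (trans (sym (E≡ u w)) e)

walk-crosses-separator : IsSeparation k G A B → (∀ u w → Edge K u w → Edge G u w) →
  Path K u w → u ∈ V A → u ∉ V B → w ∈ V B →
  ∃₂ λ p x → Edge K p x × p ∈ V A × p ∉ V B × x ∈ V A ∩ V B
walk-crosses-separator sep K⊆G (here _) _ u∉B w∈B = contradiction w∈B u∉B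
walk-crosses-separator {B = B} sep@(gA , gB , _) K⊆G (step {x = x} e walk) u∈A u∉B w∈B
  with separation-edge sep (K⊆G _ _ e)
... | inj₂ e∈B = contradiction (Edge⇒source∈V gB e∈B) u∉B
... | inj₁ e∈A with x ∈? V B
...   | yes x∈B = _ , x , e , u∈A , u∉B , x∈p∩q⁺ (Edge⇒target∈V gA e∈A , x∈B)
...   | no  x∉B = walk-crosses-separator sep K⊆G walk (Edge⇒target∈V gA e∈A) x∉B w∈B

separator-neighbour : IsGraph G → ThreeConnected G → IsSeparation 3 G A B → v ∈ V A ∩ V B →
  ∃ λ p → Edge G v p × p ∈ V A × p ∉ V B
separator-neighbour {G = G} {A = A} {B = B} {v = v}
  (E-sym , _) (_ , cut) sep@(_ , _ , _ , _ , _ , ∣A∩B∣≡3 , ∣A∣>3 , _) v∈A∩B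
  with a , a∈A , a∉B ← ∣p∩q∣<∣p∣⇒x∈p∧x∉q (subst (_< ∣ V A ∣) (sym ∣A∩B∣≡3) ∣A∣>3)
  = neighbour (walk-crosses-separator sep (λ _ _ → proj₁ ∘ deleteSet-edge⁻ G S)
                 (walk-to-v a∈A a∉B) a∈A a∉B v∈B)
  where
  v∈B = proj₂ (x∈p∩q⁻ (V A) (V B) v∈A∩B)
  S = V A ∩ V B - v
  ∣S∣<3 : ∣ S ∣ < 3
  ∣S∣<3 = subst (∣ S ∣ <_) ∣A∩B∣≡3 (x∈p⇒∣p-x∣<∣p∣ v∈A∩B)
  ∈G─S : x ∈ V A → x ∉ S → x ∈ V G ─ S
  ∈G─S x∈A = x∈p∧x∉q⇒x∈p─q (separation-V⊆ sep x∈A)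
  walk-to-v : x ∈ V A → x ∉ V B → Path (deleteSet G S) x v
  walk-to-v x∈A x∉B =
    cut S (separation-V⊆ sep ∘ proj₁ ∘ x∈p∩q⁻ _ _ ∘ p─q⊆p _ _) ∣S∣<3 _ v
      (∈G─S x∈A (x∉B ∘ proj₂ ∘ x∈p∩q⁻ _ _ ∘ p─q⊆p _ _))
      (∈G─S (proj₁ (x∈p∩q⁻ (V A) (V B) v∈A∩B)) (λ v∈S → x∈p─q⇒x∉q _ _ v∈S (x∈⁅x⁆ v)))
  neighbour : (∃₂ λ p x → Edge (deleteSet G S) p x × p ∈ V A × p ∉ V B × x ∈ V A ∩ V B) →
              ∃ λ p → Edge G v p × p ∈ V A × p ∉ V B
  neighbour (p , x , e , p∈A , p∉B , x∈A∩B) =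
    let e , _ , x∉S = deleteSet-edge⁻ G S e
    in p , subst (λ y → Edge G y p) (x∈p∧x∉p-y⇒x≡y x∈A∩B x∉S) (E-sym p x e) , p∈A , p∉B

∣separator∩V∣≡3 : IsGraph H → Subgraph H G → ThreeConnected H → IsSeparation 3 G A B →
  u ∈ V H → u ∈ V A → u ∉ V B → w ∈ V H → w ∈ V B → w ∉ V A → ∣ (V A ∩ V B) ∩ V H ∣ ≡ 3
∣separator∩V∣≡3 {H = H} {A = A} {B = B} {u = u} {w = w} gH (_ , E⊆) (_ , cut)
  sep@(_ , _ , _ , _ , _ , ∣A∩B∣≡3 , _) u∈H u∈A u∉B w∈H w∈B w∉A =
  ≤-antisym (subst (∣ S ∣ ≤_) ∣A∩B∣≡3 (p⊆q⇒∣p∣≤∣q∣ (p∩q⊆p (V A ∩ V B) (V H)))) (≮⇒≥ ∣S∣≮3)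
  where
  S = (V A ∩ V B) ∩ V H
  separator-avoided : ¬ (∃₂ λ p x → Edge (deleteSet H S) p x × p ∈ V A × p ∉ V B × x ∈ V A ∩ V B)
  separator-avoided (_ , _ , e , _ , _ , x∈A∩B) =
    let eH , _ , x∉S = deleteSet-edge⁻ H S e
    in x∉S (x∈p∩q⁺ (x∈A∩B , Edge⇒target∈V gH eH))
  ∣S∣≮3 : ¬ ∣ S ∣ < 3
  ∣S∣≮3 ∣S∣<3 = separator-avoided
    (walk-crosses-separator sep (λ u w → E⊆ u w ∘ proj₁ ∘ deleteSet-edge⁻ H S) walk u∈A u∉B w∈B)
    where
    walk : Path (deleteSet H S) u w
    walk = cut S (p∩q⊆q _ _) ∣S∣<3 u w
      (x∈p∧x∉q⇒x∈p─q u∈H (u∉B ∘ proj₂ ∘ x∈p∩q⁻ _ _ ∘ proj₁ ∘ x∈p∩q⁻ _ _))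
      (x∈p∧x∉q⇒x∈p─q w∈H (w∉A ∘ proj₁ ∘ x∈p∩q⁻ _ _ ∘ proj₁ ∘ x∈p∩q⁻ _ _))

restrict-separation : ∀ {k′} S → IsGraph H → Subgraph H G → IsSeparation k G A B →
  let A′ = deleteSet (A ⊓ H) S
      B′ = deleteSet (B ⊓ H) S
  in ∣ V A′ ∩ V B′ ∣ ≡ k′ →
     (∃ λ a → a ∈ V A′ × a ∉ V B′) → (∃ λ b → b ∈ V B′ × b ∉ V A′) →
     IsSeparation k′ (deleteSet H S) A′ B′
restrict-separation {H = H} {A = A} {B = B} S gH (V⊆ , E⊆) (gA , gB , disjoint , V≡ , E≡ , _)
  ∣A′∩B′∣≡k′ (_ , a∈A′ , a∉B′) (_ , b∈B′ , b∉A′) =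
  deleteSet-isGraph (A ⊓ H) S (⊓-isGraph A H gA gH) ,
  deleteSet-isGraph (B ⊓ H) S (⊓-isGraph B H gB gH) ,
  (λ u w (eA′ , eB′) → disjoint u w (restricted-edge A eA′ , restricted-edge B eB′)) ,
  ∪-restrict (V A) (V B) (V H) S (subst (_ ∈_) (sym V≡) ∘ V⊆) ,
  (λ u w → ∧-∨-restrict (E A u w) (E B u w) (E H u w) _ (λ eH → trans (sym (E≡ u w)) (E⊆ u w eH))) ,
  ∣A′∩B′∣≡k′ ,
  subst (λ k → suc k ≤ _) ∣A′∩B′∣≡k′ (x∈p∧x∉q⇒∣p∩q∣<∣p∣ a∈A′ a∉B′) ,
  subst (λ k → suc k ≤ _) (trans (cong ∣_∣ (∩-comm (V B ∩ V H ─ S) (V A ∩ V H ─ S))) ∣A′∩B′∣≡k′)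
    (x∈p∧x∉q⇒∣p∩q∣<∣p∣ b∈B′ b∉A′)
  where
  restricted-edge : ∀ C → Edge (deleteSet (C ⊓ H) S) u w → Edge C u w
  restricted-edge C = proj₁ ∘ ⊓-edge⁻ C H ∘ proj₁ ∘ deleteSet-edge⁻ (C ⊓ H) S

restricted-side : ∀ (A B H : RawGraph n) → v ∈ V B → x ∈ V H → x ∈ V A → x ∉ V B →
  x ∈ V ((A ⊓ H) -v v) × x ∉ V ((B ⊓ H) -v v)
restricted-side {v = v} A B H v∈B x∈H x∈A x∉B =
  x∈p∧x∉q⇒x∈p─q (x∈p∩q⁺ (x∈A , x∈H))
    (λ x∈⁅v⁆ → x∉B (subst (_∈ V B) (sym (x∈⁅y⁆⇒x≡y v x∈⁅v⁆)) v∈B)) ,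
  x∉B ∘ proj₁ ∘ x∈p∩q⁻ (V B) (V H) ∘ p─q⊆p (V B ∩ V H) ⁅ v ⁆

lemma4p1 : ∀ {n : ℕ} (G H A B : RawGraph n) (v : Fin n) →
    IsGraph G → ThreeConnected G →
    IsGraph H → Subgraph H G → ThreeConnected H →
    Private G H v →
    IsSeparation 3 G A B →
    v ∈ (V A ∩ V B) →
    IsSeparation 2 (H -v v) ((A ⊓ H) -v v) ((B ⊓ H) -v v)
lemma4p1 G H A B v gG 3cG gH H⊆G 3cH (v∈H , N[v]⊆H) sep v∈A∩B
  with a , v-a , a∈A , a∉B ← separator-neighbour gG 3cG sep v∈A∩B
     | b , v-b , b∈B , b∉A ← separator-neighbour gG 3cG (IsSeparation-sym sep)
                                (x∈p∩q⁺ (swap (x∈p∩q⁻ (V A) (V B) v∈A∩B)))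
  = restrict-separation ⁅ v ⁆ gH H⊆G sep ∣separator-v∣≡2
      (a , restricted-side A B H v∈B a∈H a∈A a∉B) (b , restricted-side B A H v∈A b∈H b∈B b∉A)
  where
  v∈A = proj₁ (x∈p∩q⁻ (V A) (V B) v∈A∩B)
  v∈B = proj₂ (x∈p∩q⁻ (V A) (V B) v∈A∩B)
  a∈H = N[v]⊆H a v-a
  b∈H = N[v]⊆H b v-b
  ∣separator-v∣≡2 : ∣ V ((A ⊓ H) -v v) ∩ V ((B ⊓ H) -v v) ∣ ≡ 2
  ∣separator-v∣≡2 = trans (cong ∣_∣ (∩-restrict (V A) (V B) (V H) ⁅ v ⁆))
    (suc-injective (trans (sym (x∈p⇒∣p∣≡suc∣p-x∣ (x∈p∩q⁺ (v∈A∩B , v∈H))))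
                          (∣separator∩V∣≡3 gH H⊆G 3cH sep a∈H a∈A a∉B b∈H b∈B b∉A)))
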